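{- In each of the four calculi $\mathbf{G3}^{\varphi}_{\mathsf N}$, $\mathbf{G3}^{\varphi}_{\mathsf{NeF}}$, $\mathbf{G3}^{\varphi}_{\mathsf{CoPC}}$, $\mathbf{G3}^{\varphi}_{\mathsf{MPC}}$, the weakening rule is admissible: if $\Gamma\Rightarrow\varphi$ is derivable, then so is $\Gamma,\alpha\Rightarrow\varphi$, for every formula $\alpha$.
   Context: Formulas are built from a countable set of propositional variables $p,q,\dots$ and the constant $\top$ (there is no $\bot$) using binary $\land,\lor,\to$ and unary $\neg$. A sequent is $\Gamma\Rightarrow\varphi$ with $\Gamma$ a finite multiset of formulas and $\varphi$ a single formula (the goal). The positive rules are: (ax) $\Gamma,p\Rightarrow p$ for a propositional variable $p$; ($\top$) $\Gamma\Rightarrow\top$; ($\to$r) from $\Gamma,\alpha\Rightarrow\beta$ infer $\Gamma\Rightarrow\alpha\to\beta$; ($\to$l) from $\Gamma,\alpha\to\beta\Rightarrow\alpha$ and $\Gamma,\beta\Rightarrow\varphi$ infer $\Gamma,\alpha\to\beta\Rightarrow\varphi$; ($\land$r) from $\Gamma\Rightarrow\alpha$ and $\Gamma\Rightarrow\beta$ infer $\Gamma\Rightarrow\alpha\land\beta$; ($\land$l) from $\Gamma,\alpha,\beta\Rightarrow\varphi$ infer $\Gamma,\alpha\land\beta\Rightarrow\varphi$; ($\lor$r$_1$), ($\lor$r$_2$) from $\Gamma\Rightarrow\alpha$ (resp. $\Gamma\Rightarrow\beta$) infer $\Gamma\Rightarrow\alpha\lor\beta$; ($\lor$l) from $\Gamma,\alpha\Rightarrow\varphi$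 and $\Gamma,\beta\Rightarrow\varphi$ infer $\Gamma,\alpha\lor\beta\Rightarrow\varphi$. The negation rules are: (n) from $\Gamma,\neg\alpha,\beta\Rightarrow\alpha$ and $\Gamma,\neg\alpha,\alpha\Rightarrow\beta$ infer $\Gamma,\neg\alpha\Rightarrow\neg\beta$; (nef) from $\Gamma,\neg\alpha\Rightarrow\alpha$ infer $\Gamma,\neg\alpha\Rightarrow\neg\beta$; (copc) from $\Gamma,\neg\alpha,\beta\Rightarrow\alpha$ infer $\Gamma,\neg\alpha\Rightarrow\neg\beta$; (an) from $\Gamma,\alpha\Rightarrow\neg\alpha$ infer $\Gamma\Rightarrow\neg\alpha$. The calculi $\mathbf{G3}_{\mathsf N}$, $\mathbf{G3}_{\mathsf{NeF}}$, $\mathbf{G3}_{\mathsf{CoPC}}$, $\mathbf{G3}_{\mathsf{MPC}}$ (without structural rules) consist of the positive rules plus, respectively, (n); (n) and (nef); (copc); (copc) and (an). For each of them, $\mathbf{G3}^{\varphi}$ denotes the calculus obtained by restricting the left rules ($\to$l), ($\land$l), ($\lor$l) to instances whose goal $\varphi$ is an atom, a negation, or a disjunction. -}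

module Defs where

open import Data.Nat using (ℕ)
open import Data.List using (List; _∷_; [])
open import Data.List.Relation.Binary.Permutation.Propositional using (_↭_)
open import Data.Product using (_×_)
open import Data.Sum using (_⊎_)
open import Data.Unit using (⊤)
open import Data.Empty using (⊥)
open import Data.Bool using (Bool; true; false)

data Fm : Set where
  var  : ℕ → Fm
  top  : Fm
  _∧'_ : Fm → Fm → Fm
  _∨'_ : Fm → Fm → Fm
  _⇒_  : Fm → Fm → Fm
  ¬'_  : Fm → Fm

-- Finite multisets of formulas are represented by lists, taken up to
-- permutation: "Δ is Γ,α" is expressed as  Δ ↭ α ∷ Γ.
Ctx : Set
Ctx = List Fm

data Calculus : Set where
  N NeF CoPC MPC : Calculus

HasN : Calculus → Set
HasN N = ⊤
HasN NeF = ⊤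
HasN CoPC = ⊥
HasN MPC = ⊥

HasNeF : Calculus → Set
HasNeF NeF = ⊤
HasNeF _ = ⊥

HasCoPC : Calculus → Set
HasCoPC CoPC = ⊤
HasCoPC MPC = ⊤
HasCoPC _ = ⊥

HasAN : Calculus → Set
HasAN MPC = ⊤
HasAN _ = ⊥

-- Goals allowed for the left rules in G3^φ: atom, negation or disjunction.
-- (We read "atom" as propositional variable or ⊤.)
PhiGoal : Fm → Set
PhiGoal (var _) = ⊤
PhiGoal top = ⊤
PhiGoal (¬' _) = ⊤
PhiGoal (_ ∨' _) = ⊤
PhiGoal (_ ∧' _) = ⊥
PhiGoal (_ ⇒ _) = ⊥

infix 4 _⊢_⇒_
data _⊢_⇒_ (L : Calculus) : Ctx → Fm → Set where
  ax   : ∀ {Γ Δ} n → Δ ↭ var n ∷ Γ → L ⊢ Δ ⇒ var n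
  topR : ∀ {Γ} → L ⊢ Γ ⇒ top
  impR : ∀ {Γ α β} → L ⊢ α ∷ Γ ⇒ β → L ⊢ Γ ⇒ (α ⇒ β)
  impL : ∀ {Γ Δ α β φ} → PhiGoal φ → Δ ↭ (α ⇒ β) ∷ Γ →
         L ⊢ (α ⇒ β) ∷ Γ ⇒ α → L ⊢ β ∷ Γ ⇒ φ → L ⊢ Δ ⇒ φ
  andR : ∀ {Γ α β} → L ⊢ Γ ⇒ α → L ⊢ Γ ⇒ β → L ⊢ Γ ⇒ (α ∧' β)
  andL : ∀ {Γ Δ α β φ} → PhiGoal φ → Δ ↭ (α ∧' β) ∷ Γ →
         L ⊢ α ∷ β ∷ Γ ⇒ φ → L ⊢ Δ ⇒ φ
  orR₁ : ∀ {Γ α β} → L ⊢ Γ ⇒ α → L ⊢ Γ ⇒ (α ∨' β)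
  orR₂ : ∀ {Γ α β} → L ⊢ Γ ⇒ β → L ⊢ Γ ⇒ (α ∨' β)
  orL  : ∀ {Γ Δ α β φ} → PhiGoal φ → Δ ↭ (α ∨' β) ∷ Γ →
         L ⊢ α ∷ Γ ⇒ φ → L ⊢ β ∷ Γ ⇒ φ → L ⊢ Δ ⇒ φ
  negN   : ∀ {Γ Δ α β} → HasN L → Δ ↭ (¬' α) ∷ Γ →
           L ⊢ β ∷ (¬' α) ∷ Γ ⇒ α → L ⊢ α ∷ (¬' α) ∷ Γ ⇒ β → L ⊢ Δ ⇒ ¬' β
  negNeF : ∀ {Γ Δ α β} → HasNeF L → Δ ↭ (¬' α) ∷ Γ →
           L ⊢ (¬' α) ∷ Γ ⇒ α → L ⊢ Δ ⇒ ¬' β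
  negCoPC : ∀ {Γ Δ α β} → HasCoPC L → Δ ↭ (¬' α) ∷ Γ →
            L ⊢ β ∷ (¬' α) ∷ Γ ⇒ α → L ⊢ Δ ⇒ ¬' β
  negAN  : ∀ {Γ α} → HasAN L → L ⊢ α ∷ Γ ⇒ ¬' α → L ⊢ Γ ⇒ ¬' α

module Submission where

-- Contexts are lists read up to permutation, and every rule that acts on a
-- context formula (ax, the left rules, the negation rules with principal ¬α)
-- locates it by a permutation  Δ ↭ π ∷ Γ.  We therefore prove the stronger,
-- permutation-invariant statement  `weaken`: from  L ⊢ Γ ⇒ φ  and any
-- Δ ↭ α ∷ Γ  we get  L ⊢ Δ ⇒ φ.  The proof is by induction on the
-- derivation: the new formula α is pushed past the formulas that a rule adds
-- to the context of its premises (`insert-under₁`, `insert-under₂`), and the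
-- location of a principal context formula is transported along the
-- weakening (`principal-after-weakening`).  The side conditions PhiGoal and
-- HasX concern only the goal and the calculus, so they are unchanged.

open import Defs
open import Data.List using (List; _∷_)
open import Data.List.Relation.Binary.Permutation.Propositional
  using (_↭_; refl; prep; swap; trans)

principal-after-weakening : ∀ {A : Set} {α π : A} {Γ Δ Δ' : List A} →
  Δ' ↭ α ∷ Δ → Δ ↭ π ∷ Γ → Δ' ↭ π ∷ α ∷ Γ
principal-after-weakening {α = α} {π} q p = trans q (trans (prep α p) (swap α π refl))

insert-under₁ : ∀ {A : Set} {α a : A} {Γ : List A} → a ∷ α ∷ Γ ↭ α ∷ a ∷ Γ
insert-under₁ = swap _ _ refl

insert-under₂ : ∀ {A : Set} {α a b : A} {Γ : List A} →
  a ∷ b ∷ α ∷ Γ ↭ α ∷ a ∷ b ∷ Γ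
insert-under₂ = trans (prep _ insert-under₁) (swap _ _ refl)

weaken : ∀ {L Γ Δ φ α} → L ⊢ Γ ⇒ φ → Δ ↭ α ∷ Γ → L ⊢ Δ ⇒ φ
weaken (ax n p)             q = ax n (principal-after-weakening q p)
weaken topR                 q = topR
weaken (impR d)             q = impR (weaken d (trans (prep _ q) insert-under₁))
weaken (impL g p d e)       q = impL g (principal-after-weakening q p)
                                  (weaken d insert-under₁) (weaken e insert-under₁)
weaken (andR d e)           q = andR (weaken d q) (weaken e q)
weaken (andL g p d)         q = andL g (principal-after-weakening q p) (weaken d insert-under₂)
weaken (orR₁ d)             q = orR₁ (weaken d q)
weaken (orR₂ d)             q = orR₂ (weaken d q)
weaken (orL g p d e)        q = orL g (principal-after-weakening q p)
                                  (weaken d insert-under₁) (weaken e insert-under₁)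
weaken (negN h p d e)       q = negN h (principal-after-weakening q p)
                                  (weaken d insert-under₂) (weaken e insert-under₂)
weaken (negNeF h p d)       q = negNeF h (principal-after-weakening q p) (weaken d insert-under₁)
weaken (negCoPC h p d)      q = negCoPC h (principal-after-weakening q p) (weaken d insert-under₂)
weaken (negAN h d)          q = negAN h (weaken d (trans (prep _ q) insert-under₁))

lemma5p1 : (L : Calculus) → ∀ {Γ φ} → (α : Fm) → L ⊢ Γ ⇒ φ → L ⊢ α ∷ Γ ⇒ φ
lemma5p1 L α d = weaken d refl
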